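{- Let $G$ be a finite group. The following are equivalent: (a) the commuting graph of $G$ is equal to the conjugacy supercommuting graph of $G$; (b) the centralizer of every element of $G$ is a normal subgroup of $G$; (c) $G$ is a $2$-Engel group, i.e. $[[x,g],g]=1$ for all $x,g\in G$.
   Context: $[x,y]=x^{ -1}y^{ -1}xy$. The commuting graph of $G$ has vertex set $G$, with distinct $g,h$ adjacent iff $gh=hg$. The conjugacy supercommuting graph of $G$ has vertex set $G$, with distinct $g,h$ adjacent iff there exist a conjugate $g'$ of $g$ and a conjugate $h'$ of $h$ with $g'h'=h'g'$ (in particular, conjugate elements are always adjacent). -}

module Defs where

open import Level using (Level; _⊔_)
open import Data.Nat using (ℕ)
open import Data.Fin using (Fin)
open import Data.Product using (Σ; ∃; _×_)
open import Relation.Nullary using (¬_)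
open import Function.Bundles using (Inverse; _⇔_)
open import Algebra.Bundles using (Group)
import Relation.Binary.PropositionalEquality as ≡

IsFiniteGroup : ∀ {c ℓ} → Group c ℓ → Set (c ⊔ ℓ)
IsFiniteGroup G = ∃ λ (n : ℕ) → Inverse (≡.setoid (Fin n)) (Group.setoid G)

module GroupNotions {c ℓ} (G : Group c ℓ) where
  open Group G

  [_,_] : Carrier → Carrier → Carrier
  [ x , y ] = x ⁻¹ ∙ y ⁻¹ ∙ x ∙ y

  Commute : Carrier → Carrier → Set ℓ
  Commute g h = g ∙ h ≈ h ∙ g

  IsConjugate : Carrier → Carrier → Set (c ⊔ ℓ)
  IsConjugate g' g = ∃ λ a → g' ≈ a ⁻¹ ∙ g ∙ a

  CommAdj : Carrier → Carrier → Set ℓ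
  CommAdj g h = ¬ (g ≈ h) × Commute g h

  SuperCommAdj : Carrier → Carrier → Set (c ⊔ ℓ)
  SuperCommAdj g h = ¬ (g ≈ h) ×
    (∃ λ g' → ∃ λ h' → IsConjugate g' g × IsConjugate h' h × Commute g' h')

  -- (a) the two graphs (same vertex set G) have the same edge set
  CommutingGraph≡SuperCommutingGraph : Set (c ⊔ ℓ)
  CommutingGraph≡SuperCommutingGraph = ∀ g h → CommAdj g h ⇔ SuperCommAdj g h

  Centralizer : Carrier → Carrier → Set ℓ
  Centralizer g x = Commute x g

  -- a subset closed under conjugation (centralizers are always subgroups)
  IsNormalSubset : (Carrier → Set ℓ) → Set (c ⊔ ℓ)
  IsNormalSubset H = ∀ x h → H h → H (x ⁻¹ ∙ h ∙ x)

  AllCentralizersNormal : Set (c ⊔ ℓ)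
  AllCentralizersNormal = ∀ g → IsNormalSubset (Centralizer g)

  Is2Engel : Set (c ⊔ ℓ)
  Is2Engel = ∀ x g → [ [ x , g ] , g ] ≈ ε

{-# OPTIONS --safe #-}
-- C(g) is normal for every g exactly when every element commutes with all of
-- its conjugates, and since [x , g] = (g⁻¹)^x ∙ g the latter is the 2-Engel law.
-- The substantial step is that commuting with one's own conjugates already puts
-- every conjugate g^y into C(g): for h ∈ C(g) both h ∙ y and y commute with
-- [y , g], since (h ∙ y)^g = h ∙ y ∙ [y , g] and y^g = y ∙ [y , g]; hence so
-- does h, and with it (g⁻¹)^y = [y , g] ∙ g⁻¹. Normal centralizers let conjugates
-- be moved off both endpoints of a supercommuting edge; conversely, equal graphs
-- give normality by a case split on h^x ≈ g, which needs decidable equality,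
-- available because G is finite.
module Submission where

open import Level using (_⊔_)
open import Defs
open import Data.Product using (_×_; _,_; proj₂)
open import Data.Fin using (Fin)
open import Data.Fin.Properties using (_≟_)
open import Function.Bundles using (_⇔_; mk⇔; Equivalence; Inverse)
import Function.Properties.Inverse as Inverseₚ
import Function.Properties.Equivalence as ⇔
open import Algebra.Bundles using (Group)
open import Relation.Binary.Bundles using (Setoid)
open import Relation.Binary.Definitions using (Decidable)
import Relation.Binary.PropositionalEquality as ≡
open import Relation.Nullary.Decidable using (yes; no; via-injection)
import Algebra.Properties.Group as GroupProperties
import Relation.Binary.Reasoning.Setoid as SetoidReasoning

module TwoEngel {c ℓ} (G : Group c ℓ) where
  open Group G
  open GroupProperties G
  open GroupNotions G
  open SetoidReasoning setoid

  infixl 7.5 _^_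

  _^_ : Carrier → Carrier → Carrier
  g ^ x = x ⁻¹ ∙ g ∙ x

  ConjugatesCommute : Set (c ⊔ ℓ)
  ConjugatesCommute = ∀ g x → Commute g (g ^ x)

  module _ {a : Carrier} where

    commute-refl : Commute a a
    commute-refl = refl

    commute-sym : ∀ {b} → Commute a b → Commute b a
    commute-sym = sym

    commute-resp : ∀ {a' b b'} → a ≈ a' → b ≈ b' → Commute a b → Commute a' b'
    commute-resp {a'} {b} {b'} a≈a' b≈b' ab = begin
      a' ∙ b' ≈⟨ ∙-cong a≈a' b≈b' ⟨
      a ∙ b   ≈⟨ ab ⟩
      b ∙ a   ≈⟨ ∙-cong b≈b' a≈a' ⟩
      b' ∙ a' ∎

    commute-∙ʳ : ∀ {b c} → Commute a b → Commute a c → Commute a (b ∙ c)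
    commute-∙ʳ {b} {c} ab ac = begin
      a ∙ (b ∙ c) ≈⟨ assoc a b c ⟨
      a ∙ b ∙ c   ≈⟨ ∙-congʳ ab ⟩
      b ∙ a ∙ c   ≈⟨ assoc b a c ⟩
      b ∙ (a ∙ c) ≈⟨ ∙-congˡ ac ⟩
      b ∙ (c ∙ a) ≈⟨ assoc b c a ⟨
      b ∙ c ∙ a   ∎

    commute-⁻¹ʳ : ∀ {b} → Commute a b → Commute a (b ⁻¹)
    commute-⁻¹ʳ {b} ab = begin
      a ∙ b ⁻¹                 ≈⟨ ∙-congʳ (\\-leftDividesʳ b a) ⟨
      b ⁻¹ ∙ (b ∙ a) ∙ b ⁻¹    ≈⟨ ∙-congʳ (∙-congˡ ab) ⟨
      b ⁻¹ ∙ (a ∙ b) ∙ b ⁻¹    ≈⟨ ∙-congʳ (assoc (b ⁻¹) a b) ⟨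
      b ⁻¹ ∙ a ∙ b ∙ b ⁻¹      ≈⟨ //-rightDividesʳ b (b ⁻¹ ∙ a) ⟩
      b ⁻¹ ∙ a                 ∎

    commute-cancelˡ : ∀ {b c} → Commute a (b ∙ c) → Commute a b → Commute a c
    commute-cancelˡ {b} {c} abc ab =
      commute-resp refl (\\-leftDividesʳ b c) (commute-∙ʳ (commute-⁻¹ʳ ab) abc)

    commute-cancelʳ : ∀ {b c} → Commute a (b ∙ c) → Commute a c → Commute a b
    commute-cancelʳ {b} {c} abc ac =
      commute-resp refl (//-rightDividesʳ c b) (commute-∙ʳ abc (commute-⁻¹ʳ ac))

  commutator≈ : ∀ x y → [ x , y ] ≈ (y ∙ x) ⁻¹ ∙ (x ∙ y)
  commutator≈ x y = begin
    x ⁻¹ ∙ y ⁻¹ ∙ x ∙ y     ≈⟨ assoc (x ⁻¹ ∙ y ⁻¹) x y ⟩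
    x ⁻¹ ∙ y ⁻¹ ∙ (x ∙ y)   ≈⟨ ∙-congʳ (⁻¹-anti-homo-∙ y x) ⟨
    (y ∙ x) ⁻¹ ∙ (x ∙ y)    ∎

  commutator≈ε⇔commute : ∀ x y → [ x , y ] ≈ ε ⇔ Commute x y
  commutator≈ε⇔commute x y = mk⇔ to from
    where
    to : [ x , y ] ≈ ε → Commute x y
    to [x,y]≈ε = begin
      x ∙ y          ≈⟨ inverseʳ-unique _ _ (trans (sym (commutator≈ x y)) [x,y]≈ε) ⟩
      (y ∙ x) ⁻¹ ⁻¹  ≈⟨ ⁻¹-involutive (y ∙ x) ⟩
      y ∙ x          ∎
    from : Commute x y → [ x , y ] ≈ ε
    from xy = begin
      [ x , y ]              ≈⟨ commutator≈ x y ⟩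
      (y ∙ x) ⁻¹ ∙ (x ∙ y)   ≈⟨ ∙-congˡ xy ⟩
      (y ∙ x) ⁻¹ ∙ (y ∙ x)   ≈⟨ inverseˡ (y ∙ x) ⟩
      ε                      ∎

  ^-congˡ : ∀ {g h} x → g ≈ h → g ^ x ≈ h ^ x
  ^-congˡ x g≈h = ∙-congʳ (∙-congˡ g≈h)

  ^-ε : ∀ g → g ^ ε ≈ g
  ^-ε g = begin
    ε ⁻¹ ∙ g ∙ ε ≈⟨ identityʳ _ ⟩
    ε ⁻¹ ∙ g     ≈⟨ ∙-congʳ ε⁻¹≈ε ⟩
    ε ∙ g        ≈⟨ identityˡ g ⟩
    g            ∎

  ^-^⁻¹ : ∀ g x → g ^ x ^ x ⁻¹ ≈ g
  ^-^⁻¹ g x = begin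
    x ⁻¹ ⁻¹ ∙ (x ⁻¹ ∙ g ∙ x) ∙ x ⁻¹ ≈⟨ ∙-congʳ (∙-congʳ (⁻¹-involutive x)) ⟩
    x ∙ (x ⁻¹ ∙ g ∙ x) ∙ x ⁻¹       ≈⟨ ∙-congʳ (assoc x (x ⁻¹ ∙ g) x) ⟨
    x ∙ (x ⁻¹ ∙ g) ∙ x ∙ x ⁻¹       ≈⟨ //-rightDividesʳ x _ ⟩
    x ∙ (x ⁻¹ ∙ g)                  ≈⟨ \\-leftDividesˡ x g ⟩
    g                               ∎

  ⁻¹-^ : ∀ g x → (g ^ x) ⁻¹ ≈ g ⁻¹ ^ x
  ⁻¹-^ g x = begin
    (x ⁻¹ ∙ g ∙ x) ⁻¹        ≈⟨ ⁻¹-anti-homo-∙ (x ⁻¹ ∙ g) x ⟩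
    x ⁻¹ ∙ (x ⁻¹ ∙ g) ⁻¹     ≈⟨ ∙-congˡ (⁻¹-anti-homo-∙ (x ⁻¹) g) ⟩
    x ⁻¹ ∙ (g ⁻¹ ∙ x ⁻¹ ⁻¹)  ≈⟨ ∙-congˡ (∙-congˡ (⁻¹-involutive x)) ⟩
    x ⁻¹ ∙ (g ⁻¹ ∙ x)        ≈⟨ assoc (x ⁻¹) (g ⁻¹) x ⟨
    x ⁻¹ ∙ g ⁻¹ ∙ x          ∎

  ^-⁻¹-⁻¹ : ∀ g x → (g ⁻¹ ^ x) ⁻¹ ≈ g ^ x
  ^-⁻¹-⁻¹ g x = trans (⁻¹-^ (g ⁻¹) x) (^-congˡ x (⁻¹-involutive g))

  ^≈∙commutator : ∀ g x → g ^ x ≈ g ∙ [ g , x ]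
  ^≈∙commutator g x = sym (begin
    g ∙ (g ⁻¹ ∙ x ⁻¹ ∙ g ∙ x)     ≈⟨ assoc g (g ⁻¹ ∙ x ⁻¹ ∙ g) x ⟨
    g ∙ (g ⁻¹ ∙ x ⁻¹ ∙ g) ∙ x     ≈⟨ ∙-congʳ (assoc g (g ⁻¹ ∙ x ⁻¹) g) ⟨
    g ∙ (g ⁻¹ ∙ x ⁻¹) ∙ g ∙ x     ≈⟨ ∙-congʳ (∙-congʳ (\\-leftDividesˡ g (x ⁻¹))) ⟩
    x ⁻¹ ∙ g ∙ x                  ∎)

  ∙-^-central : ∀ {h g} y → Commute h g → (h ∙ y) ^ g ≈ h ∙ y ^ g
  ∙-^-central {h} {g} y hg = begin
    g ⁻¹ ∙ (h ∙ y) ∙ g   ≈⟨ ∙-congʳ (assoc (g ⁻¹) h y) ⟨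
    g ⁻¹ ∙ h ∙ y ∙ g     ≈⟨ ∙-congʳ (∙-congʳ (commute-⁻¹ʳ hg)) ⟨
    h ∙ g ⁻¹ ∙ y ∙ g     ≈⟨ ∙-congʳ (assoc h (g ⁻¹) y) ⟩
    h ∙ (g ⁻¹ ∙ y) ∙ g   ≈⟨ assoc h (g ⁻¹ ∙ y) g ⟩
    h ∙ y ^ g            ∎

  centralizersNormal⇒conjugatesCommute : AllCentralizersNormal → ConjugatesCommute
  centralizersNormal⇒conjugatesCommute normal g x = commute-sym (normal g x g commute-refl)

  conjugatesCommute⇒commute-^ : ConjugatesCommute → ∀ {h g} → Commute h g →
                                ∀ y → Commute h (g ^ y)
  conjugatesCommute⇒commute-^ conjCommute {h} {g} hg y =
    commute-resp refl (^-⁻¹-⁻¹ g y) (commute-⁻¹ʳ h∼g⁻¹^y)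
    where
    y∼[y,g] : Commute y [ y , g ]
    y∼[y,g] = commute-cancelˡ
      (commute-resp refl (^≈∙commutator y g) (conjCommute y g)) commute-refl

    hy^g≈hy∙[y,g] : (h ∙ y) ^ g ≈ h ∙ y ∙ [ y , g ]
    hy^g≈hy∙[y,g] = begin
      (h ∙ y) ^ g          ≈⟨ ∙-^-central y hg ⟩
      h ∙ y ^ g            ≈⟨ ∙-congˡ (^≈∙commutator y g) ⟩
      h ∙ (y ∙ [ y , g ])  ≈⟨ assoc h y _ ⟨
      h ∙ y ∙ [ y , g ]    ∎

    hy∼[y,g] : Commute (h ∙ y) [ y , g ]
    hy∼[y,g] = commute-cancelˡ
      (commute-resp refl hy^g≈hy∙[y,g] (conjCommute (h ∙ y) g)) commute-refl

    h∼[y,g] : Commute h [ y , g ]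
    h∼[y,g] = commute-sym
      (commute-cancelʳ (commute-sym hy∼[y,g]) (commute-sym y∼[y,g]))

    -- [ y , g ] unfolds definitionally to g ⁻¹ ^ y ∙ g.
    h∼g⁻¹^y : Commute h (g ⁻¹ ^ y)
    h∼g⁻¹^y = commute-cancelʳ h∼[y,g] hg

  conjugatesCommute⇒centralizersNormal : ConjugatesCommute → AllCentralizersNormal
  conjugatesCommute⇒centralizersNormal conjCommute g x h hg =
    commute-sym (conjugatesCommute⇒commute-^ conjCommute (commute-sym hg) x)

  centralizersNormal⇔conjugatesCommute : AllCentralizersNormal ⇔ ConjugatesCommute
  centralizersNormal⇔conjugatesCommute =
    mk⇔ centralizersNormal⇒conjugatesCommute conjugatesCommute⇒centralizersNormal

  commute-commutator⇔commute-^ : ∀ g x → Commute g [ x , g ] ⇔ Commute g (g ^ x)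
  commute-commutator⇔commute-^ g x = mk⇔ to from
    where
    to : Commute g [ x , g ] → Commute g (g ^ x)
    to g∼[x,g] =
      commute-resp refl (^-⁻¹-⁻¹ g x) (commute-⁻¹ʳ (commute-cancelʳ g∼[x,g] commute-refl))
    from : Commute g (g ^ x) → Commute g [ x , g ]
    from g∼g^x =
      commute-∙ʳ (commute-resp refl (⁻¹-^ g x) (commute-⁻¹ʳ g∼g^x)) commute-refl

  conjugatesCommute⇔2Engel : ConjugatesCommute ⇔ Is2Engel
  conjugatesCommute⇔2Engel = mk⇔ to from
    where
    to : ConjugatesCommute → Is2Engel
    to conjCommute x g = Equivalence.from (commutator≈ε⇔commute [ x , g ] g)
      (commute-sym (Equivalence.from (commute-commutator⇔commute-^ g x) (conjCommute g x)))
    from : Is2Engel → ConjugatesCommute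
    from engel g x = Equivalence.to (commute-commutator⇔commute-^ g x)
      (commute-sym (Equivalence.to (commutator≈ε⇔commute [ x , g ] g) (engel x g)))

  commAdj⇒superCommAdj : ∀ {g h} → CommAdj g h → SuperCommAdj g h
  commAdj⇒superCommAdj {g} {h} (g≉h , gh) =
    g≉h , g , h , (ε , sym (^-ε g)) , (ε , sym (^-ε h)) , gh

  commute-unconjugateˡ : AllCentralizersNormal → ∀ {g h} x → Commute (g ^ x) h → Commute g h
  commute-unconjugateˡ normal {g} {h} x g^x∼h =
    commute-resp (^-^⁻¹ g x) refl (normal h (x ⁻¹) (g ^ x) g^x∼h)

  superCommAdj⇒commAdj : AllCentralizersNormal → ∀ {g h} → SuperCommAdj g h → CommAdj g h
  superCommAdj⇒commAdj normal {g} {h} (g≉h , g' , h' , (a , g'≈g^a) , (b , h'≈h^b) , g'h') =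
    g≉h , commute-sym (commute-unconjugateˡ normal b (commute-sym g∼h^b))
    where
    g∼h^b : Commute g (h ^ b)
    g∼h^b = commute-unconjugateˡ normal a (commute-resp g'≈g^a h'≈h^b g'h')

  centralizersNormal⇒graphs≡ : AllCentralizersNormal → CommutingGraph≡SuperCommutingGraph
  centralizersNormal⇒graphs≡ normal g h =
    mk⇔ commAdj⇒superCommAdj (superCommAdj⇒commAdj normal)

  graphs≡⇒centralizersNormal : Decidable _≈_ → CommutingGraph≡SuperCommutingGraph →
                               AllCentralizersNormal
  graphs≡⇒centralizersNormal ≈-dec graphs≡ g x h hg with ≈-dec (h ^ x) g
  ... | yes h^x≈g = commute-resp (sym h^x≈g) refl commute-refl
  ... | no h^x≉g = proj₂ (Equivalence.from (graphs≡ (h ^ x) g)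
        (h^x≉g , h , g , (x ⁻¹ , sym (^-^⁻¹ h x)) , (ε , sym (^-ε g)) , hg))

≈-decidable-viaFin : ∀ {a ℓ n} {S : Setoid a ℓ} → Inverse (≡.setoid (Fin n)) S →
                     Decidable (Setoid._≈_ S)
≈-decidable-viaFin Fin↔S = via-injection (Inverseₚ.Inverse⇒Injection (Inverseₚ.sym Fin↔S)) _≟_

mainTheorem3 : ∀ {c ℓ} (G : Group c ℓ) → IsFiniteGroup G →
    let open GroupNotions G in
    (CommutingGraph≡SuperCommutingGraph ⇔ AllCentralizersNormal)
      × (AllCentralizersNormal ⇔ Is2Engel)
mainTheorem3 G finite =
  mk⇔ (graphs≡⇒centralizersNormal (≈-decidable-viaFin (proj₂ finite))) centralizersNormal⇒graphs≡ ,
  ⇔.trans centralizersNormal⇔conjugatesCommute conjugatesCommute⇔2Engel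
  where open TwoEngel G
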